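{- Let $\mathcal{H}$ be a $q$-patchwork stitched to a graph $G$. Then $\llbracket\mathcal{H}\rrbracket$ is a minor of $G$.
   Context: All graphs are finite and simple. A $q$-patch $H$ is a triple $(\llbracket H\rrbracket,a_H,b_H)$, $\llbracket H\rrbracket$ a graph, $a_H,b_H:[q]\to V(\llbracket H\rrbracket)$ injective; $\partial_lH=a_H([q])$, $\partial_rH=b_H([q])$, $\partial H=\partial_lH\cup\partial_rH$. The product $H_1\times H_2$ identifies $b_{H_1}(i)$ with $a_{H_2}(i)$ in disjoint copies, with $a=a_{H_1}$, $b=b_{H_2}$. A $q$-patchwork is a sequence $\mathcal{H}=(H_1,\dots,H_l)$ of $q$-patches; $V(\mathcal{H})=\bigcup_iV(H_i)$ and $\llbracket\mathcal{H}\rrbracket=\llbracket H_1\times\cdots\times H_l\rrbracket$. A patch $H$ is embedded in $G$ if $\llbracket H\rrbracket=G[X]$ for some $X\subseteq V(G)$ and each $v\in V(G)-X$ has all its neighbours in $X$ inside $\partial_lH$ or all inside $\partial_rH$. $\mathcal{H}$ is embedded in $G$ if (E1) every $H_i$ is embedded in $G$; (E2) if $v\in V(H_i)\cap V(H_j)$ for $i\ne j$ then $v\in\partial_lH_k\cap\partial_rH_k$ for all $k\in[l]$; (E3) for every $v\in V(\mathcal{H})$ and $i\in[l]$, if $v$ has a neighbour in $V(H_i)$ then $v\in V(H_i)$; (E4) for every $v\in V(G)-V(\mathcal{H})$ there is $i\in[l]$ such that all neighbours of $v$ in $V(\mathcal{H})$ lie in $\partial_lH_i$ or all lie in $\partial_rH_i$.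 $\mathcal{H}$ is stitched to $G$ if $\mathcal{H}$ is embedded in $G$ and there is a collection of paths $(P_{i,j})_{i\in[q],j\in[l-1]}$ in $G$ such that $P_{i,j}$ has ends $b_{H_j}(i)$ and $a_{H_{j+1}}(i)$ and is otherwise disjoint from $V(\mathcal{H})$, and if $V(P_{i,j})\cap V(P_{i',j'})\ne\emptyset$ for some $j\le j'$ then $i=i'$ and either $j=j'$ or $j=j'-1$, and in the latter case $P_{i,j}\cap P_{i',j'}$ is a common subpath of the two paths with an end $a_{H_{j'}}(i)=b_{H_{j'}}(i)$. -}

module Defs where

open import Data.Nat using (ℕ; suc; _≤_)
open import Data.Bool using (Bool; true; false; T)
open import Data.Fin using (Fin; toℕ; inject₁) renaming (suc to fsuc)
open import Data.Fin.Subset using (Subset) renaming (_∈_ to _∈ₛ_; _∉_ to _∉ₛ_)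
open import Data.List using (List; []; _∷_; _++_; reverse)
open import Data.List.Membership.Propositional using (_∈_)
open import Data.List.Relation.Unary.All using (All)
open import Data.List.Relation.Unary.Linked using (Linked)
open import Data.List.Relation.Unary.Unique.Propositional using (Unique)
open import Data.Product using (Σ; ∃; ∃₂; _×_; _,_)
open import Data.Sum using (_⊎_)
open import Data.Empty using (⊥)
open import Function.Definitions using (Injective)
open import Relation.Nullary using (¬_)
open import Relation.Binary.PropositionalEquality using (_≡_)
open import Relation.Binary.Construct.Closure.Equivalence using (EqClosure)

record Graph : Set where
  field
    n          : ℕ
    adj        : Fin n → Fin n → Bool
    adj-sym    : ∀ u v → adj u v ≡ adj v u
    adj-irrefl : ∀ v → adj v v ≡ false

  Adj : Fin n → Fin n → Set
  Adj u v = T (adj u v)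

open Graph public

lastOf : {A : Set} → A → List A → A
lastOf x []       = x
lastOf x (y ∷ ys) = lastOf y ys

record Path (G : Graph) (x y : Fin (n G)) : Set where
  field
    rest   : List (Fin (n G))
    linked : Linked (Adj G) (x ∷ rest)
    unique : Unique (x ∷ rest)
    ends   : lastOf x rest ≡ y

  verts : List (Fin (n G))
  verts = x ∷ rest

open Path public

-- A graph is presented by a vertex
-- type V, an equivalence relation _≈_ on V (the actual vertices are the
-- ≈-classes), and a relation E on V (two classes are adjacent iff they
-- have E-related representatives).  An ordinary graph is the case where
-- ≈ is ≡.

record GraphPres : Set₁ where
  field
    V   : Set
    _≈_ : V → V → Set
    E   : V → V → Set

record Minor (H : GraphPres) (G : Graph) : Set₁ where
  open GraphPres H
  field
    branch    : V → Fin (n G) → Set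
    resp      : ∀ {u v} → u ≈ v → ∀ x → branch u x → branch v x
    nonempty  : ∀ u → ∃ λ x → branch u x
    connected : ∀ u x y → branch u x → branch u y →
                Σ (Path G x y) λ P → All (branch u) (verts P)
    disjoint  : ∀ u v → ¬ (u ≈ v) → ∀ x → branch u x → branch v x → ⊥
    edges     : ∀ u v → E u v →
                ∃₂ λ x y → branch u x × branch v y × Adj G x y

-- q-patches embedded in G.  Since an embedded patch H satisfies
-- ⟦H⟧ = G[X] for some X ⊆ V(G), such a patch is given by X together
-- with the injective maps a_H, b_H : [q] → X.  ([q] = Fin q.)

record Patch (G : Graph) (q : ℕ) : Set where
  field
    X    : Subset (n G)
    a    : Fin q → Fin (n G)
    b    : Fin q → Fin (n G)
    a-inj : Injective _≡_ _≡_ a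
    b-inj : Injective _≡_ _≡_ b
    a∈X  : ∀ i → a i ∈ₛ X
    b∈X  : ∀ i → b i ∈ₛ X

open Patch public

∂l : ∀ {G q} → Patch G q → Fin (n G) → Set
∂l H v = ∃ λ i → a H i ≡ v

∂r : ∀ {G q} → Patch G q → Fin (n G) → Set
∂r H v = ∃ λ i → b H i ≡ v

-- A q-patchwork (H_1, ..., H_l) with l = suc m patches (0-indexed).
Patchwork : Graph → ℕ → ℕ → Set
Patchwork G q m = Fin (suc m) → Patch G q

InV : ∀ {G q m} → Patchwork G q m → Fin (n G) → Set
InV 𝓗 v = ∃ λ i → v ∈ₛ X (𝓗 i)

-- H embedded in G (the condition ⟦H⟧ = G[X] holds by construction).
PatchEmbedded : ∀ {G q} → Patch G q → Set
PatchEmbedded {G} H =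
  ∀ v → v ∉ₛ X H →
    (∀ u → Adj G v u → u ∈ₛ X H → ∂l H u) ⊎
    (∀ u → Adj G v u → u ∈ₛ X H → ∂r H u)

record Embedded (G : Graph) {q m : ℕ} (𝓗 : Patchwork G q m) : Set where
  field
    E1 : ∀ i → PatchEmbedded (𝓗 i)
    E2 : ∀ i j v → ¬ (i ≡ j) → v ∈ₛ X (𝓗 i) → v ∈ₛ X (𝓗 j) →
         ∀ k → ∂l (𝓗 k) v × ∂r (𝓗 k) v
    E3 : ∀ v → InV 𝓗 v → ∀ i →
         (∃ λ u → u ∈ₛ X (𝓗 i) × Adj G v u) → v ∈ₛ X (𝓗 i)
    E4 : ∀ v → ¬ InV 𝓗 v → ∃ λ i →
         (∀ u → InV 𝓗 u → Adj G v u → ∂l (𝓗 i) u) ⊎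
         (∀ u → InV 𝓗 u → Adj G v u → ∂r (𝓗 i) u)

CommonSubpath : {A : Set} → List A → List A → Set
CommonSubpath L L' =
  ∃ λ S → (∃ λ A → L ≡ A ++ S) × (∃ λ B → L' ≡ reverse S ++ B) ×
          (∀ v → (v ∈ L × v ∈ L') → v ∈ S) × (∀ v → v ∈ S → v ∈ L × v ∈ L')

record Stitching (G : Graph) {q m : ℕ} (𝓗 : Patchwork G q m) : Set where
  field
    P        : (i : Fin q) (j : Fin m) →
               Path G (b (𝓗 (inject₁ j)) i) (a (𝓗 (fsuc j)) i)
    internal : ∀ i j v → v ∈ verts (P i j) → InV 𝓗 v →
               (v ≡ b (𝓗 (inject₁ j)) i) ⊎ (v ≡ a (𝓗 (fsuc j)) i)
    overlaps : ∀ i i′ j j′ → toℕ j ≤ toℕ j′ →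
               (∃ λ v → v ∈ verts (P i j) × v ∈ verts (P i′ j′)) →
               i ≡ i′ ×
               (j ≡ j′ ⊎
                (suc (toℕ j) ≡ toℕ j′ ×
                 a (𝓗 (inject₁ j′)) i ≡ b (𝓗 (inject₁ j′)) i ×
                 CommonSubpath (verts (P i j)) (verts (P i′ j′))))

Stitched : (G : Graph) {q m : ℕ} → Patchwork G q m → Set
Stitched G 𝓗 = Embedded G 𝓗 × Stitching G 𝓗

-- ⟦𝓗⟧ = ⟦H_1 × ⋯ × H_l⟧: disjoint copies of the ⟦H_i⟧ = G[X_i], with
-- b_{H_j}(k) identified with a_{H_{j+1}}(k) for all k and j.

PVert : ∀ {G q m} → Patchwork G q m → Set
PVert {G} 𝓗 = Σ (Fin _) λ i → Σ (Fin (n G)) λ v → v ∈ₛ X (𝓗 i)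

data Glue {G : Graph} {q m : ℕ} (𝓗 : Patchwork G q m) :
          PVert 𝓗 → PVert 𝓗 → Set where
  glue : ∀ (j : Fin m) (k : Fin q) p p′ →
         Glue 𝓗 (inject₁ j , b (𝓗 (inject₁ j)) k , p)
                (fsuc j , a (𝓗 (fsuc j)) k , p′)

data PAdj {G : Graph} {q m : ℕ} (𝓗 : Patchwork G q m) :
          PVert 𝓗 → PVert 𝓗 → Set where
  padj : ∀ i u v p p′ → Adj G u v → PAdj 𝓗 (i , u , p) (i , v , p′)

⟦_⟧ : ∀ {G q m} → Patchwork G q m → GraphPres
⟦ 𝓗 ⟧ = record { V = PVert 𝓗 ; _≈_ = EqClosure (Glue 𝓗) ; E = PAdj 𝓗 }

-- The branch set of a vertex of ⟦𝓗⟧ consists of all its copies in G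
-- together with the stitching paths leaving those copies.  Two copies of
-- the same vertex of G are glued in ⟦𝓗⟧: inside one patch trivially, and
-- across patches because (E2) puts the vertex on every boundary, where
-- the stitching paths through it identify consecutive copies.  Paths
-- only meet at their ends or along a common subpath of two consecutive
-- paths of the same thread, so branch sets of distinct vertices are
-- disjoint; a walk along the gluings (each one a stitching path) shows
-- that each branch set is connected, and edges of ⟦𝓗⟧ are edges of G.
module Submission where

open import Defs
open import Data.Nat using (ℕ; suc; _≤_)
open import Data.Nat.Properties using (≤-refl; ≤-total)
open import Data.Bool using (T)
open import Data.Vec.Properties.WithK using ([]=-irrelevant)
open import Data.Fin using (Fin; toℕ; inject₁) renaming (suc to fsuc; zero to fzero)
open import Data.Fin.Properties using (toℕ-inject₁; toℕ-injective; _≟_)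
open import Data.Fin.Subset using () renaming (_∈_ to _∈ₛ_)
open import Data.List using (List; []; _∷_)
open import Data.List.Membership.Propositional using (_∈_)
import Data.List.Membership.DecPropositional as DecMembership
open import Data.List.Relation.Unary.Any using (here; there)
open import Data.List.Relation.Unary.All using (All; []; _∷_; tabulate)
open import Data.List.Relation.Unary.All.Properties using (¬Any⇒All¬)
open import Data.List.Relation.Unary.AllPairs using ([]; _∷_)
open import Data.List.Relation.Unary.Linked using (Linked; [-]; _∷_)
open import Data.List.Relation.Unary.Unique.Propositional using (Unique)
open import Data.Product using (Σ; _×_; _,_; proj₁; proj₂)
open import Data.Sum using (_⊎_; inj₁; inj₂)
open import Function using (id)
open import Relation.Binary.Core using (Rel)
open import Relation.Nullary using (yes; no)
open import Relation.Binary.PropositionalEquality using (_≡_; refl; sym; trans; subst; cong)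
open import Relation.Binary.Construct.Closure.Equivalence using (EqClosure)
import Relation.Binary.Construct.Closure.Equivalence as EqClosure
open import Relation.Binary.Construct.Closure.ReflexiveTransitive
  using (Star; ε; _◅_; _◅◅_; gmap; fold; reverse)
open import Relation.Binary.Construct.Closure.Symmetric using (SymClosure; fwd; bwd)

chain-from-zero : ∀ {m ℓ} {R : Rel (Fin (suc m)) ℓ} →
                  (∀ j → R (inject₁ j) (fsuc j)) → ∀ i → Star R fzero i
chain-from-zero step fzero = ε
chain-from-zero {suc m} {R = R} step (fsuc i) =
  step fzero ◅ gmap fsuc id (chain-from-zero {R = λ x y → R (fsuc x) (fsuc y)} (λ j → step (fsuc j)) i)

lastOf∈ : {A : Set} (x : A) (xs : List A) → lastOf x xs ∈ x ∷ xs
lastOf∈ x []       = here refl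
lastOf∈ x (y ∷ ys) = there (lastOf∈ y ys)

module Walks (G : Graph) where

  Vertex : Set
  Vertex = Fin (n G)

  open DecMembership (_≟_ {n G}) using (_∈?_)

  Adj-sym : ∀ {x y} → Adj G x y → Adj G y x
  Adj-sym {x} {y} = subst T (adj-sym G x y)

  Step : (Vertex → Set) → Rel Vertex _
  Step B x y = B x × B y × Adj G x y

  Walk : (Vertex → Set) → Rel Vertex _
  Walk B = Star (Step B)

  PathIn : (Vertex → Set) → Vertex → Vertex → Set
  PathIn B x y = Σ (Path G x y) λ Q → All B (verts Q)

  module _ {B : Vertex → Set} where

    Step-sym : ∀ {x y} → Step B x y → Step B y x
    Step-sym (bx , by , e) = by , bx , Adj-sym e

    reverseʷ : ∀ {x y} → Walk B x y → Walk B y x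
    reverseʷ = reverse Step-sym

    linked⇒walk : ∀ x xs → Linked (Adj G) (x ∷ xs) → All B (x ∷ xs) →
                  ∀ {z} → z ∈ x ∷ xs → Walk B x z
    linked⇒walk x xs       _        _                (here refl) = ε
    linked⇒walk x (y ∷ ys) (e ∷ l) (bx ∷ al@(by ∷ _)) (there z∈) =
      (bx , by , e) ◅ linked⇒walk y ys l al z∈

    path⇒walk : ∀ {x y z} (Q : Path G x y) → All B (verts Q) → z ∈ verts Q → Walk B x z
    path⇒walk Q allQ = linked⇒walk _ (rest Q) (linked Q) allQ

    path⇒walk-to-end : ∀ {x y} (Q : Path G x y) → All B (verts Q) → Walk B x y
    path⇒walk-to-end {x} Q allQ =
      subst (Walk B x) (ends Q) (path⇒walk Q allQ (lastOf∈ x (rest Q)))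

    private
      suffix : ∀ {w} x xs → w ∈ x ∷ xs →
               Linked (Adj G) (x ∷ xs) → Unique (x ∷ xs) → All B (x ∷ xs) →
               Σ (List Vertex) λ ys → Linked (Adj G) (w ∷ ys) × Unique (w ∷ ys) ×
                 lastOf w ys ≡ lastOf x xs × All B (w ∷ ys)
      suffix x xs       (here refl) l       u       al       = xs , l , u , refl , al
      suffix x (y ∷ ys) (there w∈)  (_ ∷ l) (_ ∷ u) (_ ∷ al) = suffix y ys w∈ l u al

    suffixPath : ∀ {w y z} (Q : Path G y z) → All B (verts Q) → w ∈ verts Q → PathIn B w z
    suffixPath Q allQ w∈ with suffix _ (rest Q) w∈ (linked Q) (unique Q) allQ
    ... | ys , l , u , e , al =
      record { rest = ys ; linked = l ; unique = u ; ends = trans e (ends Q) } , al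

    -- If x already lies on the path built from the rest of the walk, cut it there.
    walk⇒path : ∀ {x y} → Walk B x y → B y → PathIn B x y
    walk⇒path ε by =
      record { rest = [] ; linked = [-] ; unique = [] ∷ [] ; ends = refl } , by ∷ []
    walk⇒path {x} ((bx , _ , e) ◅ w) bz with walk⇒path w bz
    ... | Q , allQ with x ∈? verts Q
    ...   | yes x∈Q = suffixPath Q allQ x∈Q
    ...   | no x∉Q  =
      record { rest = verts Q ; linked = e ∷ linked Q
             ; unique = ¬Any⇒All¬ (verts Q) x∉Q ∷ unique Q ; ends = ends Q } ,
      bx ∷ allQ

module StitchedPatchwork {G : Graph} {q m : ℕ} (𝓗 : Patchwork G q m) (st : Stitched G 𝓗) where
  open Walks G
  open Embedded (proj₁ st) using (E2)
  open Stitching (proj₂ st)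

  Point : Set
  Point = PVert 𝓗

  _≈_ : Rel Point _
  _≈_ = EqClosure (Glue 𝓗)

  ≈-sym : ∀ {u w} → u ≈ w → w ≈ u
  ≈-sym = EqClosure.symmetric (Glue 𝓗)

  vertex : Point → Vertex
  vertex u = proj₁ (proj₂ u)

  start : Fin m → Fin q → Point
  start j k = inject₁ j , b (𝓗 (inject₁ j)) k , b∈X (𝓗 (inject₁ j)) k

  end : Fin m → Fin q → Point
  end j k = fsuc j , a (𝓗 (fsuc j)) k , a∈X (𝓗 (fsuc j)) k

  start≈end : ∀ j k → start j k ≈ end j k
  start≈end j k = fwd (glue j k _ _) ◅ ε

  ≈-within-patch : ∀ {i v w} (p : v ∈ₛ X (𝓗 i)) (p′ : w ∈ₛ X (𝓗 i)) →
                   v ≡ w → (i , v , p) ≈ (i , w , p′)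
  ≈-within-patch p p′ refl rewrite []=-irrelevant p p′ = ε

  -- A vertex lying on every boundary, as (E2) guarantees for a vertex in
  -- two patches, has a copy in every patch, and all these copies are glued.
  module OnAllBoundaries (v : Vertex) (bd : ∀ k → ∂l (𝓗 k) v × ∂r (𝓗 k) v) where

    ∈-patch : ∀ i → v ∈ₛ X (𝓗 i)
    ∈-patch i with proj₁ (bd i)
    ... | k , aₖ≡v = subst (_∈ₛ X (𝓗 i)) aₖ≡v (a∈X (𝓗 i) k)

    copy : Fin (suc m) → Point
    copy i = i , v , ∈-patch i

    -- v starts P k j and ends P k′ j, so by the overlap condition k = k′.
    copy-step : ∀ j → copy (inject₁ j) ≈ copy (fsuc j)
    copy-step j with proj₂ (bd (inject₁ j)) | proj₁ (bd (fsuc j))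
    ... | k , bₖ≡v | k′ , aₖ′≡v
      with overlaps k k′ j j ≤-refl
             (v , here (sym bₖ≡v) ,
              subst (_∈ verts (P k′ j)) (trans (ends (P k′ j)) aₖ′≡v) (lastOf∈ _ _))
    ... | refl , _ =
      ≈-within-patch _ _ (sym bₖ≡v) ◅◅ start≈end j k ◅◅ ≈-within-patch _ _ aₖ′≡v

    copy-≈ : ∀ i i′ → copy i ≈ copy i′
    copy-≈ i i′ = ≈-sym (from-zero i) ◅◅ from-zero i′
      where
        from-zero : ∀ i → copy fzero ≈ copy i
        from-zero i = fold (λ i i′ → copy i ≈ copy i′) _◅◅_ ε (chain-from-zero copy-step i)

  same-vertex⇒≈ : ∀ u w → vertex u ≡ vertex w → u ≈ w
  same-vertex⇒≈ (i , v , p) (i′ , .v , p′) refl with i ≟ i′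
  ... | yes refl = ≈-within-patch p p′ refl
  ... | no i≢i′  =
    ≈-within-patch p (∈-patch i) refl ◅◅ copy-≈ i i′ ◅◅ ≈-within-patch (∈-patch i′) p′ refl
    where open OnAllBoundaries v (E2 i i′ v i≢i′ p p′)

  on-path⇒≈-start : ∀ w k j → vertex w ∈ verts (P k j) → w ≈ start j k
  on-path⇒≈-start w@(i , x , p) k j x∈P with internal k j x x∈P (i , p)
  ... | inj₁ x≡b = same-vertex⇒≈ w (start j k) x≡b
  ... | inj₂ x≡a = same-vertex⇒≈ w (end j k) x≡a ◅◅ ≈-sym (start≈end j k)

  meeting-paths⇒≈-start : ∀ k k′ j j′ x → toℕ j ≤ toℕ j′ →
                          x ∈ verts (P k j) → x ∈ verts (P k′ j′) → start j k ≈ start j′ k′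
  meeting-paths⇒≈-start k k′ j j′ x j≤j′ x∈P x∈P′ with overlaps k k′ j j′ j≤j′ (x , x∈P , x∈P′)
  ... | refl , inj₁ refl = ε
  ... | refl , inj₂ (1+j≡j′ , a≡b , _) =
    start≈end j k ◅◅ same-vertex⇒≈ (end j k) (start j′ k) (trans (cong (λ i → a (𝓗 i) k) fsuc-j≡j′) a≡b)
    where
      fsuc-j≡j′ : fsuc j ≡ inject₁ j′
      fsuc-j≡j′ = toℕ-injective (trans 1+j≡j′ (sym (toℕ-inject₁ j′)))

  Branch : Point → Vertex → Set
  Branch u x = (Σ Point λ w → u ≈ w × vertex w ≡ x) ⊎
               (Σ (Fin q) λ k → Σ (Fin m) λ j → u ≈ start j k × x ∈ verts (P k j))

  Branch-resp : ∀ {u w} → u ≈ w → ∀ x → Branch u x → Branch w x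
  Branch-resp u≈w x (inj₁ (w′ , u≈w′ , e))          = inj₁ (w′ , ≈-sym u≈w ◅◅ u≈w′ , e)
  Branch-resp u≈w x (inj₂ (k , j , u≈start , x∈P)) = inj₂ (k , j , ≈-sym u≈w ◅◅ u≈start , x∈P)

  Branch-overlap⇒≈ : ∀ u w x → Branch u x → Branch w x → u ≈ w
  Branch-overlap⇒≈ u w x (inj₁ (u′ , u≈u′ , refl)) (inj₁ (w′ , w≈w′ , e)) =
    u≈u′ ◅◅ same-vertex⇒≈ u′ w′ (sym e) ◅◅ ≈-sym w≈w′
  Branch-overlap⇒≈ u w x (inj₁ (u′ , u≈u′ , refl)) (inj₂ (k , j , w≈s , x∈P)) =
    u≈u′ ◅◅ on-path⇒≈-start u′ k j x∈P ◅◅ ≈-sym w≈s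
  Branch-overlap⇒≈ u w x (inj₂ (k , j , u≈s , x∈P)) (inj₁ (w′ , w≈w′ , refl)) =
    u≈s ◅◅ ≈-sym (on-path⇒≈-start w′ k j x∈P) ◅◅ ≈-sym w≈w′
  Branch-overlap⇒≈ u w x (inj₂ (k , j , u≈s , x∈P)) (inj₂ (k′ , j′ , w≈s′ , x∈P′))
    with ≤-total (toℕ j) (toℕ j′)
  ... | inj₁ j≤j′ = u≈s ◅◅ meeting-paths⇒≈-start k k′ j j′ x j≤j′ x∈P x∈P′ ◅◅ ≈-sym w≈s′
  ... | inj₂ j′≤j = u≈s ◅◅ ≈-sym (meeting-paths⇒≈-start k′ k j′ j x j′≤j x∈P′ x∈P) ◅◅ ≈-sym w≈s′

  module _ (u : Point) where

    stitching-path-in-Branch : ∀ k j → u ≈ start j k → All (Branch u) (verts (P k j))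
    stitching-path-in-Branch k j u≈s = tabulate λ x∈P → inj₂ (k , j , u≈s , x∈P)

    glue⇒walk : ∀ {w w′} → u ≈ w → Glue 𝓗 w w′ → Walk (Branch u) (vertex w) (vertex w′)
    glue⇒walk u≈w (glue j k p _) =
      path⇒walk-to-end (P k j)
        (stitching-path-in-Branch k j (u≈w ◅◅ ≈-within-patch p (b∈X (𝓗 (inject₁ j)) k) refl))

    ≈⇒walk : ∀ {w w′} → u ≈ w → Star (SymClosure (Glue 𝓗)) w w′ →
             Walk (Branch u) (vertex w) (vertex w′)
    ≈⇒walk u≈w ε             = ε
    ≈⇒walk u≈w (fwd g ◅ w≈w′) =
      glue⇒walk u≈w g ◅◅ ≈⇒walk (u≈w ◅◅ (fwd g ◅ ε)) w≈w′
    ≈⇒walk u≈w (bwd g ◅ w≈w′) =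
      reverseʷ (glue⇒walk (u≈w ◅◅ (bwd g ◅ ε)) g) ◅◅ ≈⇒walk (u≈w ◅◅ (bwd g ◅ ε)) w≈w′

    walk-from-vertex : ∀ x → Branch u x → Walk (Branch u) (vertex u) x
    walk-from-vertex x (inj₁ (w , u≈w , refl))       = ≈⇒walk ε u≈w
    walk-from-vertex x (inj₂ (k , j , u≈s , x∈P)) =
      ≈⇒walk ε u≈s ◅◅ path⇒walk (P k j) (stitching-path-in-Branch k j u≈s) x∈P

    Branch-connected : ∀ x y → Branch u x → Branch u y → PathIn (Branch u) x y
    Branch-connected x y bx by =
      walk⇒path (reverseʷ (walk-from-vertex x bx) ◅◅ walk-from-vertex y by) by

  minor : Minor ⟦ 𝓗 ⟧ G
  minor = record
    { branch    = Branch
    ; resp      = Branch-resp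
    ; nonempty  = λ u → vertex u , inj₁ (u , ε , refl)
    ; connected = Branch-connected
    ; disjoint  = λ u w u≉w x bu bw → u≉w (Branch-overlap⇒≈ u w x bu bw)
    ; edges     = λ { _ _ (padj i x y p p′ e) →
                      x , y , inj₁ (_ , ε , refl) , inj₁ (_ , ε , refl) , e }
    }

lemma2p11 : (G : Graph) (q m : ℕ) (𝓗 : Patchwork G q m) →
    Stitched G 𝓗 → Minor ⟦ 𝓗 ⟧ G
lemma2p11 G q m 𝓗 st = StitchedPatchwork.minor 𝓗 st
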